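{- Let $G$ be a complete $q$-partite graph of order $n$ with $q\ge 2$. Then \[ n - q + 1 \le \mathrm{MOF}(G) \le n - q + \mathrm{MOF}(K_q). \]
   Context: A complete $q$-partite graph has its vertex set partitioned into $q\ge 2$ nonempty independent sets (parts), with every edge between vertices in different parts present. $K_q$ is the complete graph on $q$ vertices. An orientation of a graph assigns to each edge $\{u,v\}$ exactly one of the arcs $(u,v)$ or $(v,u)$; if $(u,v)$ is an arc, $v$ is an out-neighbor of $u$. Oriented forcing: given an orientation $D$ and a set $S$ of initially colored vertices, any colored vertex having at most $1$ non-colored out-neighbor forces that out-neighbor to become colored; this rule is applied iteratively as long as possible. $S$ is a forcing set of $D$ if at the end every vertex is colored. $F(D)$ is the minimum size of a forcing set of $D$, and $\mathrm{MOF}(H)$ is the maximum of $F(D)$ over all orientations $D$ of the graph $H$. -}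

module Defs where

open import Data.Nat using (ℕ; _≤_)
open import Data.Fin using (Fin; _≟_)
open import Data.Fin.Subset using (Subset; _∈_; ∣_∣)
open import Data.Bool using (Bool; true; false; not)
open import Data.Product using (Σ; _×_; _,_)
open import Data.Sum using (_⊎_)
open import Relation.Nullary using (¬_)
open import Relation.Nullary.Decidable using (⌊_⌋)
open import Relation.Binary.PropositionalEquality using (_≡_; _≢_)
open import Function using (id)

record Graph (n : ℕ) : Set where
  field
    adj     : Fin n → Fin n → Bool
    symm    : ∀ u v → adj u v ≡ adj v u
    irrefl  : ∀ u → adj u u ≡ false
open Graph public

-- A digraph on Fin n: arc u v ≡ true means (u,v) is an arc.
Digraph : ℕ → Set
Digraph n = Fin n → Fin n → Bool

IsOrientation : ∀ {n} → Graph n → Digraph n → Set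
IsOrientation {n} H D =
  (∀ u v → D u v ≡ true → adj H u v ≡ true) ×
  (∀ u v → adj H u v ≡ true →
     (D u v ≡ true × D v u ≡ false) ⊎ (D u v ≡ false × D v u ≡ true))

-- Final colored set of the oriented forcing process started from S:
-- the least set containing S and closed under the forcing rule
-- "a colored u with v as its only non-colored out-neighbor forces v".
data Colored {n} (D : Digraph n) (S : Subset n) : Fin n → Set where
  initial : ∀ {v} → v ∈ S → Colored D S v
  force   : ∀ {u v} → Colored D S u → D u v ≡ true →
            (∀ w → D u w ≡ true → w ≢ v → Colored D S w) →
            Colored D S v

IsForcingSet : ∀ {n} → Digraph n → Subset n → Set
IsForcingSet D S = ∀ v → Colored D S v

IsF : ∀ {n} → Digraph n → ℕ → Set
IsF {n} D k =
  Σ (Subset n) (λ S → IsForcingSet D S × ∣ S ∣ ≡ k) ×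
  (∀ S → IsForcingSet D S → k ≤ ∣ S ∣)

IsMOF : ∀ {n} → Graph n → ℕ → Set
IsMOF {n} H m =
  Σ (Digraph n) (λ D → IsOrientation H D × IsF D m) ×
  (∀ D k → IsOrientation H D → IsF D k → k ≤ m)

-- Surjectivity of the part map (all parts nonempty).
Surj : ∀ {n q} → (Fin n → Fin q) → Set
Surj {n} {q} f = ∀ (i : Fin q) → Σ (Fin n) (λ v → f v ≡ i)

-- Complete multipartite graph on Fin n whose parts are the fibres of `part`:
-- u ~ v iff part u ≠ part v.
completeMultipartite : ∀ {n q} → (Fin n → Fin q) → Graph n
completeMultipartite part = record
  { adj    = λ u v → not ⌊ part u ≟ part v ⌋
  ; symm   = λ u v → symm' u v
  ; irrefl = λ u → irr u }
  where
  open import Relation.Binary.PropositionalEquality using (refl; sym)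
  open import Relation.Nullary using (yes; no)
  symm' : ∀ u v → not ⌊ part u ≟ part v ⌋ ≡ not ⌊ part v ≟ part u ⌋
  symm' u v with part u ≟ part v | part v ≟ part u
  ... | yes _ | yes _ = refl
  ... | no _  | no _  = refl
  ... | yes p | no ¬q = Data.Empty.⊥-elim (¬q (sym p))
    where import Data.Empty
  ... | no ¬p | yes q = Data.Empty.⊥-elim (¬p (sym q))
    where import Data.Empty
  irr : ∀ u → not ⌊ part u ≟ part u ⌋ ≡ false
  irr u with part u ≟ part u
  ... | yes _ = refl
  ... | no ¬p = Data.Empty.⊥-elim (¬p refl)
    where import Data.Empty

K : (q : ℕ) → Graph q
K q = completeMultipartite {q} {q} id

module Submission where

-- Orient every edge of G from the part of smaller index to
-- the part of larger index (the "layered" orientation).  A vertex of part 0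
-- has no in-arcs, so it must be colored initially; two vertices of the same
-- part have the same in-neighbours, so a vertex forcing one of them also
-- sees the other, and hence at most one vertex per part can be left out of
-- a forcing set.  So every forcing set misses fewer than q vertices.
--
-- Fix one representative per part.  For an orientation D of
-- G, its restriction D' to the representatives is an orientation of K_q.
-- A forcing set S' of D' extends to a forcing set of D by adding all
-- n - q non-representatives, since the forcing steps of D' are then valid
-- forcing steps of D.  So F(D) ≤ n - q + F(D') ≤ n - q + MOF(K_q).

open import Defs
open import Data.Nat as ℕ using (ℕ; zero; suc; _≤_; _<_; _+_; _∸_; z≤n)
open import Data.Nat.Properties
  using (≤-refl; ≤-trans; <-irrefl; m<1+n⇒m≤n; m≤n⇒m<n∨m≡n; ≰⇒>;
         n≮0; m≤n+m; +-suc; +-comm; +-assoc; +-identityʳ; +-monoʳ-≤; +-monoˡ-≤;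
         m+[n∸m]≡n; +-∸-comm; m≤n+o⇒m∸n≤o; m+n≤o⇒m≤o∸n; module ≤-Reasoning)
open import Data.Fin using (Fin; zero; suc; _≟_; _<?_) renaming (_<_ to _<ᶠ_)
open import Data.Fin.Properties using (all?; any?; 0≢1+n; <-cmp; <⇒≢; suc-injective; injective⇒≤)
open import Data.Fin.Subset
  using (Subset; inside; outside; _∈_; _∉_; _⊆_; ∣_∣; ∁; ⊤; ⁅_⁆; _∪_; _-_)
open import Data.Fin.Subset.Properties
  using (_∈?_; ∈⊤; ∣⊤∣≡n; ∣p∣≤n; ∣∁p∣≡n∸∣p∣; x∈∁p⇒x∉p; x∉p⇒x∈∁p;
         x∈⁅x⁆; x∈⁅y⁆⇒x≡y; p⊆p∪q; x∈p∪q⁺; x∈p∪q⁻; p⊂q⇒∣p∣<∣q∣;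
         x∈p⇒∣p-x∣<∣p∣; x∈p∧x≢y⇒x∈p-y; anySubset?)
open import Data.Vec using ([]; _∷_; tabulate; here; there)
open import Data.Vec.Properties using (lookup∘tabulate; lookup⇒[]=; []=⇒lookup)
open import Data.Bool using (true; false; not)
open import Data.Bool.Properties using () renaming (_≟_ to _≟ᵇ_)
open import Data.Product using (Σ; ∃; _×_; _,_; proj₁; proj₂)
open import Data.Sum using (_⊎_; inj₁; inj₂; [_,_]′)
open import Data.Empty using (⊥-elim)
open import Relation.Nullary using (¬_; Dec; yes; no; contradiction)
open import Relation.Nullary.Decidable
  using (_×-dec_; _→-dec_; ¬?; map′; decidable-stable; ⌊_⌋)
open import Relation.Unary using (Pred; Decidable)
open import Relation.Binary using (tri<; tri≈; tri>)
open import Relation.Binary.PropositionalEquality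
  using (_≡_; _≢_; refl; sym; trans; cong; cong₂; subst)
open import Function using (_∘_; id)

⌊⌋-true : ∀ {a} {A : Set a} (a? : Dec A) → A → ⌊ a? ⌋ ≡ true
⌊⌋-true (yes _) _ = refl
⌊⌋-true (no ¬a) a = contradiction a ¬a

⌊⌋-false : ∀ {a} {A : Set a} (a? : Dec A) → ¬ A → ⌊ a? ⌋ ≡ false
⌊⌋-false (yes a) ¬a = contradiction a ¬a
⌊⌋-false (no _) _ = refl

⌊⌋-true⁻ : ∀ {a} {A : Set a} (a? : Dec A) → ⌊ a? ⌋ ≡ true → A
⌊⌋-true⁻ (yes a) _ = a
⌊⌋-true⁻ (no _) ()

select : ∀ {n ℓ} {P : Pred (Fin n) ℓ} → Decidable P → Subset n
select P? = tabulate (⌊_⌋ ∘ P?)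

∈-select⁺ : ∀ {n ℓ} {P : Pred (Fin n) ℓ} (P? : Decidable P) {x} → P x → x ∈ select P?
∈-select⁺ P? {x} px = lookup⇒[]= x _ (trans (lookup∘tabulate (⌊_⌋ ∘ P?) x) (⌊⌋-true (P? x) px))

∈-select⁻ : ∀ {n ℓ} {P : Pred (Fin n) ℓ} (P? : Decidable P) {x} → x ∈ select P? → P x
∈-select⁻ P? {x} x∈ = ⌊⌋-true⁻ (P? x) (trans (sym (lookup∘tabulate (⌊_⌋ ∘ P?) x)) ([]=⇒lookup x∈))

∣p∣+∣∁p∣≡n : ∀ {n} (p : Subset n) → ∣ p ∣ + ∣ ∁ p ∣ ≡ n
∣p∣+∣∁p∣≡n p = trans (cong (∣ p ∣ +_) (∣∁p∣≡n∸∣p∣ p)) (m+[n∸m]≡n (∣p∣≤n p))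

-- A map sending X into Y injectively on X shows ∣ X ∣ ≤ ∣ Y ∣.  The first
-- element of X is matched with its image, which is removed from Y.
injectiveOn⇒∣∣≤ : ∀ {a b} (f : Fin a → Fin b) (X : Subset a) (Y : Subset b) →
  (∀ {i} → i ∈ X → f i ∈ Y) →
  (∀ {i j} → i ∈ X → j ∈ X → f i ≡ f j → i ≡ j) → ∣ X ∣ ≤ ∣ Y ∣
injectiveOn⇒∣∣≤ f [] Y into injective = z≤n
injectiveOn⇒∣∣≤ f (outside ∷ X) Y into injective =
  injectiveOn⇒∣∣≤ (f ∘ suc) X Y (into ∘ there)
    (λ i∈X j∈X e → suc-injective (injective (there i∈X) (there j∈X) e))
injectiveOn⇒∣∣≤ f (inside ∷ X) Y into injective = begin-strict
  ∣ X ∣            ≤⟨ injectiveOn⇒∣∣≤ (f ∘ suc) X (Y - f zero) into-rest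
                        (λ i∈X j∈X e → suc-injective (injective (there i∈X) (there j∈X) e)) ⟩
  ∣ Y - f zero ∣   <⟨ x∈p⇒∣p-x∣<∣p∣ (into here) ⟩
  ∣ Y ∣            ∎
  where
  open ≤-Reasoning
  into-rest : ∀ {i} → i ∈ X → f (suc i) ∈ Y - f zero
  into-rest i∈X = x∈p∧x≢y⇒x∈p-y (into (there i∈X)) λ e → 0≢1+n (injective here (there i∈X) (sym e))

module ForcingClosure {n} (D : Digraph n) (S : Subset n) where

  Forces : Subset n → Fin n → Fin n → Set
  Forces T u v = u ∈ T × D u v ≡ true × (∀ w → D u w ≡ true → w ≢ v → w ∈ T)

  forces? : ∀ T u v → Dec (Forces T u v)
  forces? T u v = (u ∈? T) ×-dec (D u v ≟ᵇ true) ×-dec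
    all? (λ w → (D u w ≟ᵇ true) →-dec (¬? (w ≟ v) →-dec (w ∈? T)))

  Closed : Subset n → Set
  Closed T = ∀ {u v} → Forces T u v → v ∈ T

  colored⇒∈ : ∀ {T} → S ⊆ T → Closed T → ∀ {v} → Colored D S v → v ∈ T
  colored⇒∈ S⊆T closed (initial v∈S) = S⊆T v∈S
  colored⇒∈ S⊆T closed (force c arc others) =
    closed (colored⇒∈ S⊆T closed c , arc , λ w arc' w≢v → colored⇒∈ S⊆T closed (others w arc' w≢v))

  Progress : Subset n → Set
  Progress T = ∃ λ u → ∃ λ v → v ∉ T × Forces T u v

  progress? : ∀ T → Dec (Progress T)
  progress? T = any? λ u → any? λ v → ¬? (v ∈? T) ×-dec forces? T u v

  record Closure : Set where
    field
      set      : Subset n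
      initial⊆ : S ⊆ set
      sound    : ∀ {v} → v ∈ set → Colored D S v
      closed   : Closed set

  growth : ∀ {T : Subset n} {v} → v ∉ T → ∣ T ∣ < ∣ T ∪ ⁅ v ⁆ ∣
  growth {T} {v} v∉T = p⊂q⇒∣p∣<∣q∣ {p = T} (p⊆p∪q ⁅ v ⁆ , v , x∈p∪q⁺ {p = T} (inj₂ (x∈⁅x⁆ v)) , v∉T)

  -- Repeatedly perform forcing steps; as T only grows, the fuel n - ∣ T ∣
  -- suffices for the process to stop.
  grow : ∀ fuel (T : Subset n) → n ≤ ∣ T ∣ + fuel → S ⊆ T →
         (∀ {v} → v ∈ T → Colored D S v) → Closure
  grow fuel T bound S⊆T sound with progress? T
  ... | no stuck = record { set = T ; initial⊆ = S⊆T ; sound = sound ; closed = closed }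
    where
    closed : Closed T
    closed {v = v} f = decidable-stable (v ∈? T) (λ v∉T → stuck (_ , _ , v∉T , f))
  grow zero T bound S⊆T sound | yes (u , v , v∉T , _) = ⊥-elim (<-irrefl refl (begin-strict
    ∣ T ∣           <⟨ growth v∉T ⟩
    ∣ T ∪ ⁅ v ⁆ ∣   ≤⟨ ∣p∣≤n (T ∪ ⁅ v ⁆) ⟩
    n               ≤⟨ bound ⟩
    ∣ T ∣ + 0       ≡⟨ +-identityʳ ∣ T ∣ ⟩
    ∣ T ∣           ∎))
    where open ≤-Reasoning
  grow (suc fuel) T bound S⊆T sound | yes (u , v , v∉T , u∈T , arc , others) =
    grow fuel (T ∪ ⁅ v ⁆) bound' (p⊆p∪q ⁅ v ⁆ ∘ S⊆T) sound'
    where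
    bound' : n ≤ ∣ T ∪ ⁅ v ⁆ ∣ + fuel
    bound' = ≤-trans bound (subst (_≤ ∣ T ∪ ⁅ v ⁆ ∣ + fuel) (sym (+-suc ∣ T ∣ fuel)) (+-monoˡ-≤ fuel (growth v∉T)))
    sound' : ∀ {w} → w ∈ T ∪ ⁅ v ⁆ → Colored D S w
    sound' {w} w∈ with x∈p∪q⁻ T ⁅ v ⁆ w∈
    ... | inj₁ w∈T = sound w∈T
    ... | inj₂ w∈⁅v⁆ = subst (Colored D S) (sym (x∈⁅y⁆⇒x≡y v w∈⁅v⁆))
            (force (sound u∈T) arc (λ x arc' x≢v → sound (others x arc' x≢v)))

  closure : Closure
  closure = grow n S (m≤n+m n ∣ S ∣) id initial

  colored? : ∀ v → Dec (Colored D S v)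
  colored? v = map′ sound (colored⇒∈ initial⊆ closed) (v ∈? set)
    where open Closure closure

forcingSet? : ∀ {n} (D : Digraph n) S → Dec (IsForcingSet D S)
forcingSet? D S = all? (ForcingClosure.colored? D S)

Least : (ℕ → Set) → ℕ → Set
Least P k = P k × (∀ j → P j → k ≤ j)

module _ {P : ℕ → Set} (P? : ∀ k → Dec (P k)) where

  least-upTo : ∀ N → (∀ {j} → j ≤ N → ¬ P j) ⊎ ∃ (Least P)
  least-upTo zero with P? 0
  ... | yes p0 = inj₂ (0 , p0 , λ _ _ → z≤n)
  ... | no ¬p0 = inj₁ λ { z≤n → ¬p0 }
  least-upTo (suc N) with least-upTo N
  ... | inj₂ found = inj₂ found
  ... | inj₁ none with P? (suc N)
  ...   | yes p = inj₂ (suc N , p , λ j pj → ≰⇒> (λ j≤N → none j≤N pj))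
  ...   | no ¬p = inj₁ λ j≤1+N →
            [ (λ j<1+N → none (m<1+n⇒m≤n j<1+N)) , (λ { refl → ¬p }) ]′ (m≤n⇒m<n∨m≡n j≤1+N)

  least : ∀ {N} → P N → ∃ (Least P)
  least {N} pN = [ (λ none → ⊥-elim (none ≤-refl pN)) , id ]′ (least-upTo N)

HasForcingSetOfSize : ∀ {n} → Digraph n → ℕ → Set
HasForcingSetOfSize {n} D k = Σ (Subset n) λ S → IsForcingSet D S × ∣ S ∣ ≡ k

hasForcingSetOfSize? : ∀ {n} (D : Digraph n) k → Dec (HasForcingSetOfSize D k)
hasForcingSetOfSize? D k = anySubset? λ S → forcingSet? D S ×-dec (∣ S ∣ ℕ.≟ k)

F-exists : ∀ {n} (D : Digraph n) → ∃ (IsF D)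
F-exists {n} D with least (hasForcingSetOfSize? D) (⊤ , (λ v → initial ∈⊤) , ∣⊤∣≡n n)
... | k , has-k , minimal = k , has-k , λ S forcing → minimal ∣ S ∣ (S , forcing , refl)

module _ {n} (D : Digraph n) (S : Subset n) where

  source⇒initial : ∀ {v} → (∀ u → D u v ≡ false) → Colored D S v → v ∈ S
  source⇒initial no-in (initial v∈S) = v∈S
  source⇒initial no-in (force {u} _ arc _) = contradiction (trans (sym (no-in u)) arc) λ ()

  -- Two distinct non-initial vertices with the same in-neighbours are never
  -- colored: whoever would force one of them still sees the other uncolored.
  twins-uncolored : ∀ {x y} → (∀ u → D u x ≡ D u y) → x ≢ y → x ∉ S → y ∉ S →
                    ¬ Colored D S x
  twins-uncolored same x≢y x∉S y∉S (initial x∈S) = x∉S x∈S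
  twins-uncolored same x≢y x∉S y∉S (force {u} _ arc others) =
    twins-uncolored (sym ∘ same) (x≢y ∘ sym) y∉S x∉S
      (others _ (trans (sym (same u)) arc) (x≢y ∘ sym))

module Layered {n q} (part : Fin n → Fin (suc q)) where

  layered : Digraph n
  layered u v = ⌊ part u <? part v ⌋

  layered-orientation : IsOrientation (completeMultipartite part) layered
  layered-orientation = arcs-are-edges , edges-oriented
    where
    arcs-are-edges : ∀ u v → layered u v ≡ true → not ⌊ part u ≟ part v ⌋ ≡ true
    arcs-are-edges u v arc = cong not (⌊⌋-false (part u ≟ part v) (<⇒≢ (⌊⌋-true⁻ _ arc)))
    edges-oriented : ∀ u v → not ⌊ part u ≟ part v ⌋ ≡ true →
      (layered u v ≡ true × layered v u ≡ false) ⊎ (layered u v ≡ false × layered v u ≡ true)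
    edges-oriented u v edge with <-cmp (part u) (part v)
    ... | tri< u<v _ v≮u = inj₁ (⌊⌋-true (_ <? _) u<v , ⌊⌋-false (_ <? _) v≮u)
    ... | tri> u≮v _ v<u = inj₂ (⌊⌋-false (_ <? _) u≮v , ⌊⌋-true (_ <? _) v<u)
    ... | tri≈ _ same _ =
      contradiction (trans (cong not (sym (⌊⌋-true (part u ≟ part v) same))) edge) λ ()

  -- Every forcing set misses fewer vertices than there are parts: it
  -- contains part 0 (sources) and all but at most one vertex of each other
  -- part (twins).
  forcing-complement-bound : ∀ S → IsForcingSet layered S → ∣ ∁ S ∣ < suc q
  forcing-complement-bound S forcing = begin-strict
    ∣ ∁ S ∣          ≤⟨ injectiveOn⇒∣∣≤ part (∁ S) (⊤ {suc q} - zero) into-nonzero injective ⟩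
    ∣ ⊤ {suc q} - zero ∣ <⟨ x∈p⇒∣p-x∣<∣p∣ (∈⊤ {x = zero {q}}) ⟩
    ∣ ⊤ {suc q} ∣    ≡⟨ ∣⊤∣≡n (suc q) ⟩
    suc q            ∎
    where
    open ≤-Reasoning
    into-nonzero : ∀ {v} → v ∈ ∁ S → part v ∈ ⊤ {suc q} - zero
    into-nonzero {v} v∈∁S = x∈p∧x≢y⇒x∈p-y ∈⊤ λ in-0 →
      x∈∁p⇒x∉p v∈∁S (source⇒initial layered S (no-arc-into in-0) (forcing v))
      where
      no-arc-into : part v ≡ zero → ∀ u → layered u v ≡ false
      no-arc-into in-0 u = ⌊⌋-false (part u <? part v) (n≮0 ∘ subst (part u <ᶠ_) in-0)
    injective : ∀ {x y} → x ∈ ∁ S → y ∈ ∁ S → part x ≡ part y → x ≡ y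
    injective {x} {y} x∈∁S y∈∁S same-part = decidable-stable (x ≟ y) λ x≢y →
      twins-uncolored layered S (λ u → cong (⌊_⌋ ∘ (part u <?_)) same-part) x≢y
        (x∈∁p⇒x∉p x∈∁S) (x∈∁p⇒x∉p y∈∁S) (forcing x)

restrict : ∀ {m n} → (Fin m → Fin n) → Digraph n → Digraph m
restrict emb D i j = D (emb i) (emb j)

induced-orientation : ∀ {m n} (H : Graph n) (H' : Graph m) (emb : Fin m → Fin n) →
  (∀ i j → adj H (emb i) (emb j) ≡ adj H' i j) →
  ∀ {D} → IsOrientation H D → IsOrientation H' (restrict emb D)
induced-orientation H H' emb induced (arcs-are-edges , edges-oriented) =
  (λ i j arc → trans (sym (induced i j)) (arcs-are-edges _ _ arc)) ,
  (λ i j edge → edges-oriented _ _ (trans (induced i j) edge))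

module Representatives {n q} (part : Fin n → Fin q) (rep : Fin q → Fin n)
                       (rep-section : ∀ i → part (rep i) ≡ i) where

  rep-injective : ∀ {i j} → rep i ≡ rep j → i ≡ j
  rep-injective {i} {j} e = trans (sym (rep-section i)) (trans (cong part e) (rep-section j))

  rep-orientation : ∀ {D} → IsOrientation (completeMultipartite part) D →
                    IsOrientation (K q) (restrict rep D)
  rep-orientation = induced-orientation (completeMultipartite part) (K q) rep
    λ i j → cong₂ (λ a b → not ⌊ a ≟ b ⌋) (rep-section i) (rep-section j)

  -- Extend a set S' of parts to the vertices: all non-representatives,
  -- together with the representatives of the parts in S'.
  extend : Subset q → Subset n
  extend S' = select λ v → (v ≟ rep (part v)) →-dec (part v ∈? S')

  module _ (S' : Subset q) where

    rep∈extend : ∀ {i} → i ∈ S' → rep i ∈ extend S'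
    rep∈extend {i} i∈S' = ∈-select⁺ _ λ _ → subst (_∈ S') (sym (rep-section i)) i∈S'

    rep∈extend⁻ : ∀ {i} → rep i ∈ extend S' → i ∈ S'
    rep∈extend⁻ {i} ri∈ =
      subst (_∈ S') (rep-section i) (∈-select⁻ _ ri∈ (cong rep (sym (rep-section i))))

    nonrep∈extend : ∀ {v} → v ≢ rep (part v) → v ∈ extend S'
    nonrep∈extend v≢rep = ∈-select⁺ _ λ v≡rep → contradiction v≡rep v≢rep

    extend-complement : ∣ ∁ S' ∣ ≤ ∣ ∁ (extend S') ∣
    extend-complement = injectiveOn⇒∣∣≤ rep (∁ S') (∁ (extend S'))
      (λ i∈∁S' → x∉p⇒x∈∁p (x∈∁p⇒x∉p i∈∁S' ∘ rep∈extend⁻))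
      (λ _ _ → rep-injective)

    -- Forcing steps among representatives remain valid in D once all
    -- non-representatives are colored.
    lift : ∀ {D i} → Colored (restrict rep D) S' i → Colored D (extend S') (rep i)
    lift (initial i∈S') = initial (rep∈extend i∈S')
    lift {D} (force {i} {j} c arc others) = force (lift c) arc others'
      where
      others' : ∀ w → D (rep i) w ≡ true → w ≢ rep j → Colored D (extend S') w
      others' w arc' w≢rj with w ≟ rep (part w)
      ... | no w≢rep = initial (nonrep∈extend w≢rep)
      ... | yes w≡rep = subst (Colored D (extend S')) (sym w≡rep)
              (lift (others (part w) (subst (λ x → D (rep i) x ≡ true) w≡rep arc')
                                     (λ pw≡j → w≢rj (trans w≡rep (cong rep pw≡j)))))

    extend-forcing : ∀ {D} → IsForcingSet (restrict rep D) S' → IsForcingSet D (extend S')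
    extend-forcing {D} forcing v with v ≟ rep (part v)
    ... | yes v≡rep = subst (Colored D (extend S')) (sym v≡rep) (lift (forcing (part v)))
    ... | no v≢rep = initial (nonrep∈extend v≢rep)

complement-lower : ∀ {n q} (S : Subset n) → q ≤ n → ∣ ∁ S ∣ < q → n ∸ q + 1 ≤ ∣ S ∣
complement-lower {n} {q} S q≤n missing =
  subst (_≤ ∣ S ∣) (+-∸-comm 1 q≤n) (m≤n+o⇒m∸n≤o (n + 1) q (begin
    n + 1                  ≡⟨ cong (_+ 1) (sym (∣p∣+∣∁p∣≡n S)) ⟩
    ∣ S ∣ + ∣ ∁ S ∣ + 1    ≡⟨ +-assoc ∣ S ∣ _ 1 ⟩
    ∣ S ∣ + (∣ ∁ S ∣ + 1)  ≤⟨ +-monoʳ-≤ ∣ S ∣ (subst (_≤ q) (+-comm 1 _) missing) ⟩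
    ∣ S ∣ + q              ≡⟨ +-comm ∣ S ∣ q ⟩
    q + ∣ S ∣              ∎))
  where open ≤-Reasoning

complement-upper : ∀ {n q} (S : Subset n) (S' : Subset q) → q ≤ n →
                   ∣ ∁ S' ∣ ≤ ∣ ∁ S ∣ → ∣ S ∣ ≤ n ∸ q + ∣ S' ∣
complement-upper {n} {q} S S' q≤n missing =
  subst (∣ S ∣ ≤_) (+-∸-comm ∣ S' ∣ q≤n) (m+n≤o⇒m≤o∸n ∣ S ∣ (begin
    ∣ S ∣ + q                       ≡⟨ cong (∣ S ∣ +_) (sym (∣p∣+∣∁p∣≡n S')) ⟩
    ∣ S ∣ + (∣ S' ∣ + ∣ ∁ S' ∣)     ≤⟨ +-monoʳ-≤ ∣ S ∣ (+-monoʳ-≤ ∣ S' ∣ missing) ⟩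
    ∣ S ∣ + (∣ S' ∣ + ∣ ∁ S ∣)      ≡⟨ cong (∣ S ∣ +_) (+-comm ∣ S' ∣ _) ⟩
    ∣ S ∣ + (∣ ∁ S ∣ + ∣ S' ∣)      ≡⟨ sym (+-assoc ∣ S ∣ _ _) ⟩
    ∣ S ∣ + ∣ ∁ S ∣ + ∣ S' ∣        ≡⟨ cong (_+ ∣ S' ∣) (∣p∣+∣∁p∣≡n S) ⟩
    n + ∣ S' ∣                      ∎))
  where open ≤-Reasoning

corollary15 : (n q : ℕ) → 2 ≤ q → (part : Fin n → Fin q) → Surj part →
    (m k : ℕ) → IsMOF (completeMultipartite part) m → IsMOF (K q) k →
    (n ∸ q + 1 ≤ m) × (m ≤ n ∸ q + k)
corollary15 n (suc q) _ part surj m k ((D , D-orientation , (_ , F-D-minimal)) , G-maximal)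
                                      (_ , K-maximal) = lower , upper
  where
  open Layered part
  open Representatives part (proj₁ ∘ surj) (proj₂ ∘ surj)
  open ≤-Reasoning

  parts≤n : suc q ≤ n
  parts≤n = injective⇒≤ rep-injective

  lower : n ∸ suc q + 1 ≤ m
  lower with F-exists layered
  ... | _ , F-layered@((S , S-forcing , refl) , _) =
    ≤-trans (complement-lower S parts≤n (forcing-complement-bound S S-forcing))
            (G-maximal layered _ layered-orientation F-layered)

  upper : m ≤ n ∸ suc q + k
  upper with F-exists (restrict (proj₁ ∘ surj) D)
  ... | _ , F-restricted@((S' , S'-forcing , refl) , _) = begin
    m                     ≤⟨ F-D-minimal (extend S') (extend-forcing S' S'-forcing) ⟩
    ∣ extend S' ∣         ≤⟨ complement-upper (extend S') S' parts≤n (extend-complement S') ⟩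
    n ∸ suc q + ∣ S' ∣    ≤⟨ +-monoʳ-≤ (n ∸ suc q)
                               (K-maximal _ _ (rep-orientation D-orientation) F-restricted) ⟩
    n ∸ suc q + k         ∎
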